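{- Let $G$ be a finite connected simple graph with $n$ vertices and $m$ edges, and let $k\ge 1$ be an integer. Then \[HM(S_k(G))=F(G)+4M_1(G)+16km-8m.\]
   Context: For a graph $H$ and vertex $v$, $d_H(v)$ denotes the degree of $v$ in $H$. Define $M_1(H)=\sum_{v\in V(H)} d_H(v)^2$, $F(H)=\sum_{v\in V(H)} d_H(v)^3$, and the hyper Zagreb index $HM(H)=\sum_{uv\in E(H)}(d_H(u)+d_H(v))^2$. The $k$-th subdivision graph $S_k(G)$ is the graph obtained from $G$ by inserting $k$ new vertices into each edge of $G$, i.e. each edge $uv$ of $G$ is replaced by a path from $u$ to $v$ with $k$ new internal vertices (distinct for distinct edges). -}

module Defs where

open import Data.Nat using (ℕ; _+_; _*_; _^_)
open import Data.Fin using (Fin)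
open import Data.Nat.ListAction using (sum)
open import Data.Fin.Properties using () renaming (_≟_ to _≟ᶠ_)
open import Data.List using (List; []; _∷_; map; allFin; _++_; concatMap; filter; length)
open import Data.Product using (_×_; _,_; proj₁; proj₂; ∃)
open import Data.Sum using (_⊎_; inj₁; inj₂)
import Data.Sum.Properties as SumP
import Data.Product.Properties as ProdP
open import Relation.Binary.PropositionalEquality using (_≡_; _≢_)
open import Relation.Binary.Definitions using (DecidableEquality)
open import Relation.Binary.Construct.Closure.ReflexiveTransitive using (Star)
open import Relation.Nullary using (¬_)

-- A finite (multi)graph given by an explicit vertex list and an edge list
-- (each edge an ordered pair of endpoints; orientation is irrelevant).
record Graph : Set₁ where
  field
    V     : Set
    _≟V_  : DecidableEquality V
    verts : List V
    edges : List (V × V)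

module _ (H : Graph) where
  open Graph H

  -- degree: number of edge-ends at v (equals the usual degree for loopless graphs)
  deg : V → ℕ
  deg v = length (filter (λ e → proj₁ e ≟V v) edges)
        + length (filter (λ e → proj₂ e ≟V v) edges)

  M₁ : ℕ
  M₁ = sum (map (λ v → deg v ^ 2) verts)

  Fidx : ℕ
  Fidx = sum (map (λ v → deg v ^ 3) verts)

  HM : ℕ
  HM = sum (map (λ e → (deg (proj₁ e) + deg (proj₂ e)) ^ 2) edges)

record SimpleGraph (n m : ℕ) : Set where
  field
    edge      : Fin m → Fin n × Fin n
    loopless  : ∀ i → proj₁ (edge i) ≢ proj₂ (edge i)
    -- distinct indices give distinct unordered edges
    distinct  : ∀ i j → i ≢ j →
                  ¬ (proj₁ (edge i) ≡ proj₁ (edge j) × proj₂ (edge i) ≡ proj₂ (edge j))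
    distinct′ : ∀ i j → i ≢ j →
                  ¬ (proj₁ (edge i) ≡ proj₂ (edge j) × proj₂ (edge i) ≡ proj₁ (edge j))

module _ {n m : ℕ} (G : SimpleGraph n m) where
  open SimpleGraph G

  Adj : Fin n → Fin n → Set
  Adj u v = ∃ λ i → (proj₁ (edge i) ≡ u × proj₂ (edge i) ≡ v)
                  ⊎ (proj₁ (edge i) ≡ v × proj₂ (edge i) ≡ u)

  Connected : Set
  Connected = ∀ u v → Star Adj u v

  asGraph : Graph
  asGraph = record
    { V = Fin n ; _≟V_ = _≟ᶠ_ ; verts = allFin n ; edges = map edge (allFin m) }

consec : {A : Set} → List A → List (A × A)
consec []           = []
consec (x ∷ [])     = []
consec (x ∷ y ∷ xs) = (x , y) ∷ consec (y ∷ xs)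

-- k-th subdivision: vertices are the old vertices plus k new vertices (i , j),
-- j < k, for each edge i; edge i = uv becomes the path u,(i,0),…,(i,k-1),v.
subdivision : (k : ℕ) {n m : ℕ} → SimpleGraph n m → Graph
subdivision k {n} {m} G = record
  { V     = Fin n ⊎ (Fin m × Fin k)
  ; _≟V_  = SumP.≡-dec _≟ᶠ_ (ProdP.≡-dec _≟ᶠ_ _≟ᶠ_)
  ; verts = map inj₁ (allFin n) ++ concatMap (λ i → map (λ j → inj₂ (i , j)) (allFin k)) (allFin m)
  ; edges = concatMap pathEdges (allFin m)
  }
  where
  open SimpleGraph G
  pathEdges : Fin m → List ((Fin n ⊎ (Fin m × Fin k)) × (Fin n ⊎ (Fin m × Fin k)))
  pathEdges i = consec (inj₁ (proj₁ (edge i))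
                        ∷ (map (λ j → inj₂ (i , j)) (allFin k) ++ (inj₁ (proj₂ (edge i)) ∷ [])))

-- In S_k(G) every original vertex keeps its degree d(w) and every new vertex
-- has degree 2, so the path replacing an edge uv contributes
-- (d(u)+2)² + 16(k-1) + (d(v)+2)².  Summing the end terms over all edges is a
-- weighted handshake: Σ_{uv} (h(u) + h(v)) = Σ_w d(w) h(w), and with
-- h(w) = (d(w)+2)² this is F + 4M₁ + 4·2m.
module Submission where

open import Defs
open import Data.Nat using (ℕ; suc; _+_; _*_; _∸_; _≤_; _^_)
open import Data.Nat.Properties
  using (+-comm; +-identityʳ; *-identityʳ; *-zeroʳ; *-distribˡ-+; *-distribʳ-+; m+n∸n≡m)
open import Data.Nat.ListAction using (sum)
open import Data.Nat.ListAction.Properties using (sum-++)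
open import Data.Nat.Tactic.RingSolver using (solve-∀)
open import Data.Nat.Solver using (module +-*-Solver)
open import Data.List using (List; []; _∷_; _++_; map; concatMap; filter; length; tabulate; allFin)
open import Data.List.Properties using (map-++; map-tabulate; length-map; length-tabulate)
open import Data.List.Relation.Unary.All using (All; []; _∷_; universal)
open import Data.List.Relation.Unary.All.Properties using (map⁺)
open import Data.Fin using (Fin) renaming (zero to fzero; suc to fsuc)
open import Data.Fin.Properties using (suc-injective) renaming (_≟_ to _≟ᶠ_)
open import Data.Product using (_×_; _,_; proj₁; proj₂)
open import Data.Sum using (inj₁; inj₂)
open import Data.Sum.Properties using (inj₁-injective; inj₂-injective)
open import Data.Empty using (⊥-elim)
open import Relation.Nullary using (Dec; yes; no; ¬_)
open import Relation.Unary using (Decidable)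
open import Relation.Binary.PropositionalEquality
  using (_≡_; _≢_; refl; sym; trans; cong; cong₂; module ≡-Reasoning)

∑ : {A : Set} → List A → (A → ℕ) → ℕ
∑ xs f = sum (map f xs)

syntax ∑ xs (λ x → e) = ∑[ x ∈ xs ] e

private variable A B P Q : Set

∑-cong : {f g : A → ℕ} → (∀ x → f x ≡ g x) → ∀ xs → ∑ xs f ≡ ∑ xs g
∑-cong f≡g []       = refl
∑-cong f≡g (x ∷ xs) = cong₂ _+_ (f≡g x) (∑-cong f≡g xs)

∑-zero : {f : A → ℕ} → (∀ x → f x ≡ 0) → ∀ xs → ∑ xs f ≡ 0
∑-zero f≡0 []       = refl
∑-zero f≡0 (x ∷ xs) = cong₂ _+_ (f≡0 x) (∑-zero f≡0 xs)

∑-const : (c : ℕ) (xs : List A) → ∑[ x ∈ xs ] c ≡ length xs * c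
∑-const c []       = refl
∑-const c (x ∷ xs) = cong (c +_) (∑-const c xs)

∑-+ : (f g : A → ℕ) (xs : List A) → ∑[ x ∈ xs ] (f x + g x) ≡ ∑ xs f + ∑ xs g
∑-+ f g []       = refl
∑-+ f g (x ∷ xs) = begin
  f x + g x + ∑[ y ∈ xs ] (f y + g y)   ≡⟨ cong (f x + g x +_) (∑-+ f g xs) ⟩
  f x + g x + (∑ xs f + ∑ xs g)         ≡⟨ interchange (f x) (g x) (∑ xs f) (∑ xs g) ⟩
  f x + ∑ xs f + (g x + ∑ xs g)         ∎
  where
  open ≡-Reasoning
  interchange : ∀ a b c d → a + b + (c + d) ≡ a + c + (b + d)
  interchange = solve-∀

∑-*ˡ : (c : ℕ) (f : A → ℕ) (xs : List A) → ∑[ x ∈ xs ] (c * f x) ≡ c * ∑ xs f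
∑-*ˡ c f []       = sym (*-zeroʳ c)
∑-*ˡ c f (x ∷ xs) =
  trans (cong (c * f x +_) (∑-*ˡ c f xs)) (sym (*-distribˡ-+ c (f x) (∑ xs f)))

∑-*ʳ : (c : ℕ) (f : A → ℕ) (xs : List A) → ∑[ x ∈ xs ] (f x * c) ≡ ∑ xs f * c
∑-*ʳ c f []       = refl
∑-*ʳ c f (x ∷ xs) =
  trans (cong (f x * c +_) (∑-*ʳ c f xs)) (sym (*-distribʳ-+ c (f x) (∑ xs f)))

∑-++ : (f : A → ℕ) (xs ys : List A) → ∑ (xs ++ ys) f ≡ ∑ xs f + ∑ ys f
∑-++ f xs ys = trans (cong sum (map-++ f xs ys)) (sum-++ (map f xs) (map f ys))

∑-map : (f : B → ℕ) (g : A → B) (xs : List A) →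
        ∑ (map g xs) f ≡ ∑[ x ∈ xs ] f (g x)
∑-map f g []       = refl
∑-map f g (x ∷ xs) = cong (f (g x) +_) (∑-map f g xs)

∑-concatMap : (f : B → ℕ) (g : A → List B) (xs : List A) →
              ∑ (concatMap g xs) f ≡ ∑[ x ∈ xs ] ∑ (g x) f
∑-concatMap f g []       = refl
∑-concatMap f g (x ∷ xs) =
  trans (∑-++ f (g x) (concatMap g xs)) (cong (∑ (g x) f +_) (∑-concatMap f g xs))

∑-comm : (f : A → B → ℕ) (xs : List A) (ys : List B) →
         ∑[ x ∈ xs ] ∑[ y ∈ ys ] f x y ≡ ∑[ y ∈ ys ] ∑[ x ∈ xs ] f x y
∑-comm f []       ys = sym (∑-zero (λ _ → refl) ys)
∑-comm f (x ∷ xs) ys =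
  trans (cong (∑[ y ∈ ys ] f x y +_) (∑-comm f xs ys))
        (sym (∑-+ (f x) (λ y → ∑[ x′ ∈ xs ] f x′ y) ys))

𝟙[_] : Dec P → ℕ
𝟙[ yes _ ] = 1
𝟙[ no  _ ] = 0

𝟙-yes : (p? : Dec P) → P → 𝟙[ p? ] ≡ 1
𝟙-yes (yes _) _ = refl
𝟙-yes (no ¬p) p = ⊥-elim (¬p p)

𝟙-no : (p? : Dec P) → ¬ P → 𝟙[ p? ] ≡ 0
𝟙-no (yes p) ¬p = ⊥-elim (¬p p)
𝟙-no (no _)  _  = refl

𝟙-cong : (p? : Dec P) (q? : Dec Q) → (P → Q) → (Q → P) → 𝟙[ p? ] ≡ 𝟙[ q? ]
𝟙-cong p? (yes q) _   Q→P = 𝟙-yes p? (Q→P q)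
𝟙-cong p? (no ¬q) P→Q _   = 𝟙-no p? (λ p → ¬q (P→Q p))

length-filter≡∑𝟙 : {P : A → Set} (P? : Decidable P) (xs : List A) →
                   length (filter P? xs) ≡ ∑[ x ∈ xs ] 𝟙[ P? x ]
length-filter≡∑𝟙 P? []       = refl
length-filter≡∑𝟙 P? (x ∷ xs) with P? x
... | yes _ = cong suc (length-filter≡∑𝟙 P? xs)
... | no  _ = length-filter≡∑𝟙 P? xs

length-allFin : ∀ n → length (allFin n) ≡ n
length-allFin n = length-tabulate {n = n} (λ i → i)

∑-allFin-suc : ∀ {n} (f : Fin (suc n) → ℕ) →
               ∑ (allFin (suc n)) f ≡ f fzero + ∑[ i ∈ allFin n ] f (fsuc i)
∑-allFin-suc f =
  cong (f fzero +_) (cong sum (trans (map-tabulate fsuc f) (sym (map-tabulate (λ i → i) _))))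

∑-allFin-single : ∀ {n} (f : Fin n → ℕ) (a : Fin n) → (∀ w → w ≢ a → f w ≡ 0) →
                  ∑ (allFin n) f ≡ f a
∑-allFin-single {suc n} f fzero f≡0 = begin
  ∑ (allFin (suc n)) f                        ≡⟨ ∑-allFin-suc f ⟩
  f fzero + ∑[ i ∈ allFin n ] f (fsuc i)      ≡⟨ cong (f fzero +_) (∑-zero (λ w → f≡0 (fsuc w) (λ ())) (allFin n)) ⟩
  f fzero + 0                                 ≡⟨ +-identityʳ (f fzero) ⟩
  f fzero                                     ∎
  where open ≡-Reasoning
∑-allFin-single {suc n} f (fsuc a) f≡0 = begin
  ∑ (allFin (suc n)) f                        ≡⟨ ∑-allFin-suc f ⟩
  f fzero + ∑[ i ∈ allFin n ] f (fsuc i)      ≡⟨ cong (_+ ∑[ i ∈ allFin n ] f (fsuc i)) (f≡0 fzero (λ ())) ⟩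
  ∑[ i ∈ allFin n ] f (fsuc i)                ≡⟨ ∑-allFin-single (λ i → f (fsuc i)) a
                                                   (λ w w≢a → f≡0 (fsuc w) (λ eq → w≢a (suc-injective eq))) ⟩
  f (fsuc a)                                  ∎
  where open ≡-Reasoning

∑-allFin-𝟙 : ∀ {n} (f : Fin n → ℕ) (a : Fin n) → ∑[ w ∈ allFin n ] (𝟙[ a ≟ᶠ w ] * f w) ≡ f a
∑-allFin-𝟙 f a = begin
  ∑[ w ∈ allFin _ ] (𝟙[ a ≟ᶠ w ] * f w)  ≡⟨ ∑-allFin-single _ a
                                              (λ w w≢a → cong (_* f w) (𝟙-no (a ≟ᶠ w) (λ a≡w → w≢a (sym a≡w)))) ⟩
  𝟙[ a ≟ᶠ a ] * f a                      ≡⟨ cong (_* f a) (𝟙-yes (a ≟ᶠ a) refl) ⟩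
  f a + 0                                ≡⟨ +-identityʳ (f a) ⟩
  f a                                    ∎
  where open ≡-Reasoning

map-proj₁-consec : (xs : List A) (b : A) → map proj₁ (consec (xs ++ b ∷ [])) ≡ xs
map-proj₁-consec []           b = refl
map-proj₁-consec (x ∷ [])     b = refl
map-proj₁-consec (x ∷ y ∷ xs) b = cong (x ∷_) (map-proj₁-consec (y ∷ xs) b)

map-proj₂-consec : (a : A) (xs : List A) → map proj₂ (consec (a ∷ xs)) ≡ xs
map-proj₂-consec a []       = refl
map-proj₂-consec a (x ∷ xs) = cong (x ∷_) (map-proj₂-consec x xs)

∑-consec-inner-degree-2 : (D : A → ℕ) (a y : A) (ys : List A) (b : A) →
  All (λ z → D z ≡ 2) (y ∷ ys) →
  ∑[ e ∈ consec (a ∷ y ∷ ys ++ b ∷ []) ] ((D (proj₁ e) + D (proj₂ e)) ^ 2)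
    ≡ (D a + 2) ^ 2 + 16 * length ys + (2 + D b) ^ 2
∑-consec-inner-degree-2 D a y [] b (Dy≡2 ∷ []) rewrite Dy≡2 = ends ((D a + 2) ^ 2) ((2 + D b) ^ 2)
  where
  ends : ∀ P Q → P + (Q + 0) ≡ P + 16 * 0 + Q
  ends = solve-∀
∑-consec-inner-degree-2 D a y (z ∷ zs) b (Dy≡2 ∷ Dzs≡2)
  rewrite ∑-consec-inner-degree-2 D y z zs b Dzs≡2 | Dy≡2 =
    step ((D a + 2) ^ 2) (length zs) ((2 + D b) ^ 2)
  where
  step : ∀ P l Q → P + (16 + 16 * l + Q) ≡ P + 16 * suc l + Q
  step = solve-∀

module _ {n m : ℕ} (G : SimpleGraph n m) where
  open SimpleGraph G

  private
    u v : Fin m → Fin n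
    u i = proj₁ (edge i)
    v i = proj₂ (edge i)

  deg-asGraph : ∀ w → deg (asGraph G) w ≡ ∑[ i ∈ allFin m ] (𝟙[ u i ≟ᶠ w ] + 𝟙[ v i ≟ᶠ w ])
  deg-asGraph w = trans (cong₂ _+_ (ends proj₁) (ends proj₂)) (sym (∑-+ _ _ (allFin m)))
    where
    ends : (π : Fin n × Fin n → Fin n) →
           length (filter (λ e → π e ≟ᶠ w) (map edge (allFin m))) ≡ ∑[ i ∈ allFin m ] 𝟙[ π (edge i) ≟ᶠ w ]
    ends π = trans (length-filter≡∑𝟙 (λ e → π e ≟ᶠ w) (map edge (allFin m)))
                   (∑-map (λ e → 𝟙[ π e ≟ᶠ w ]) edge (allFin m))

  handshake : (f : Fin n → ℕ) →
              ∑[ w ∈ allFin n ] (deg (asGraph G) w * f w) ≡ ∑[ i ∈ allFin m ] (f (u i) + f (v i))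
  handshake f = begin
    ∑[ w ∈ allFin n ] (deg (asGraph G) w * f w)
      ≡⟨ ∑-cong (λ w → trans (cong (_* f w) (deg-asGraph w)) (sym (∑-*ʳ (f w) _ (allFin m)))) (allFin n) ⟩
    ∑[ w ∈ allFin n ] ∑[ i ∈ allFin m ] ((𝟙[ u i ≟ᶠ w ] + 𝟙[ v i ≟ᶠ w ]) * f w)
      ≡⟨ ∑-comm _ (allFin n) (allFin m) ⟩
    ∑[ i ∈ allFin m ] ∑[ w ∈ allFin n ] ((𝟙[ u i ≟ᶠ w ] + 𝟙[ v i ≟ᶠ w ]) * f w)
      ≡⟨ ∑-cong ends (allFin m) ⟩
    ∑[ i ∈ allFin m ] (f (u i) + f (v i))
      ∎
    where
    open ≡-Reasoning
    ends : ∀ i → ∑[ w ∈ allFin n ] ((𝟙[ u i ≟ᶠ w ] + 𝟙[ v i ≟ᶠ w ]) * f w) ≡ f (u i) + f (v i)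
    ends i = begin
      ∑[ w ∈ allFin n ] ((𝟙[ u i ≟ᶠ w ] + 𝟙[ v i ≟ᶠ w ]) * f w)
        ≡⟨ ∑-cong (λ w → *-distribʳ-+ (f w) 𝟙[ u i ≟ᶠ w ] 𝟙[ v i ≟ᶠ w ]) (allFin n) ⟩
      ∑[ w ∈ allFin n ] (𝟙[ u i ≟ᶠ w ] * f w + 𝟙[ v i ≟ᶠ w ] * f w)
        ≡⟨ ∑-+ _ _ (allFin n) ⟩
      ∑[ w ∈ allFin n ] (𝟙[ u i ≟ᶠ w ] * f w) + ∑[ w ∈ allFin n ] (𝟙[ v i ≟ᶠ w ] * f w)
        ≡⟨ cong₂ _+_ (∑-allFin-𝟙 f (u i)) (∑-allFin-𝟙 f (v i)) ⟩
      f (u i) + f (v i)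
        ∎

  degree-sum : ∑[ w ∈ allFin n ] deg (asGraph G) w ≡ m * 2
  degree-sum = begin
    ∑[ w ∈ allFin n ] deg (asGraph G) w        ≡⟨ ∑-cong (λ w → sym (*-identityʳ _)) (allFin n) ⟩
    ∑[ w ∈ allFin n ] (deg (asGraph G) w * 1)  ≡⟨ handshake (λ _ → 1) ⟩
    ∑[ i ∈ allFin m ] 2                        ≡⟨ ∑-const 2 (allFin m) ⟩
    length (allFin m) * 2                      ≡⟨ cong (_* 2) (length-allFin m) ⟩
    m * 2                                      ∎
    where open ≡-Reasoning

  ∑-ends-[deg+2]² : ∑[ i ∈ allFin m ] ((deg (asGraph G) (u i) + 2) ^ 2 + (deg (asGraph G) (v i) + 2) ^ 2)
                    ≡ Fidx (asGraph G) + 4 * M₁ (asGraph G) + 4 * (m * 2)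
  ∑-ends-[deg+2]² = begin
    ∑[ i ∈ allFin m ] ((d (u i) + 2) ^ 2 + (d (v i) + 2) ^ 2)
      ≡⟨ sym (handshake (λ w → (d w + 2) ^ 2)) ⟩
    ∑[ w ∈ allFin n ] (d w * (d w + 2) ^ 2)
      ≡⟨ ∑-cong (λ w → expand (d w)) (allFin n) ⟩
    ∑[ w ∈ allFin n ] (d w ^ 3 + 4 * d w ^ 2 + 4 * d w)
      ≡⟨ ∑-+ _ _ (allFin n) ⟩
    ∑[ w ∈ allFin n ] (d w ^ 3 + 4 * d w ^ 2) + ∑[ w ∈ allFin n ] (4 * d w)
      ≡⟨ cong₂ _+_ (trans (∑-+ _ _ (allFin n)) (cong (Fidx (asGraph G) +_) (∑-*ˡ 4 (λ w → d w ^ 2) (allFin n))))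
                   (trans (∑-*ˡ 4 d (allFin n)) (cong (4 *_) degree-sum)) ⟩
    Fidx (asGraph G) + 4 * M₁ (asGraph G) + 4 * (m * 2)
      ∎
    where
    open ≡-Reasoning
    d : Fin n → ℕ
    d = deg (asGraph G)
    expand : ∀ x → x * (x + 2) ^ 2 ≡ x ^ 3 + 4 * x ^ 2 + 4 * x
    expand = solve 1 (λ x → x :* (x :+ con 2) :^ 2 := x :^ 3 :+ con 4 :* x :^ 2 :+ con 4 :* x) refl
      where open +-*-Solver

module SubdivisionDegrees {n m : ℕ} (k : ℕ) (G : SimpleGraph n m) where
  open SimpleGraph G
  open Graph (subdivision k G) using (V; _≟V_; edges)

  private
    u v : Fin m → Fin n
    u i = proj₁ (edge i)
    v i = proj₂ (edge i)

  inner : Fin m → List V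
  inner i = map (λ j → inj₂ (i , j)) (allFin k)

  walk : Fin m → List V
  walk i = inj₁ (u i) ∷ inner i ++ inj₁ (v i) ∷ []

  count : V → List V → ℕ
  count x ys = ∑[ y ∈ ys ] 𝟙[ y ≟V x ]

  count-snoc : ∀ x ys y → count x (ys ++ y ∷ []) ≡ count x ys + 𝟙[ y ≟V x ]
  count-snoc x ys y = trans (∑-++ (λ z → 𝟙[ z ≟V x ]) ys (y ∷ [])) (cong (count x ys +_) (+-identityʳ _))

  deg-subdivision : ∀ x → deg (subdivision k G) x
                        ≡ ∑[ i ∈ allFin m ] (count x (inj₁ (u i) ∷ inner i) + count x (inner i ++ inj₁ (v i) ∷ []))
  deg-subdivision x =
    trans (cong₂ _+_ (ends proj₁ (λ i → map-proj₁-consec (inj₁ (u i) ∷ inner i) (inj₁ (v i))))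
                     (ends proj₂ (λ i → map-proj₂-consec (inj₁ (u i)) (inner i ++ inj₁ (v i) ∷ []))))
          (sym (∑-+ _ _ (allFin m)))
    where
    open ≡-Reasoning
    ends : (π : V × V → V) {side : Fin m → List V} → (∀ i → map π (consec (walk i)) ≡ side i) →
           length (filter (λ e → π e ≟V x) edges) ≡ ∑[ i ∈ allFin m ] count x (side i)
    ends π {side} π-walk = begin
      length (filter (λ e → π e ≟V x) edges)
        ≡⟨ length-filter≡∑𝟙 (λ e → π e ≟V x) edges ⟩
      ∑[ e ∈ edges ] 𝟙[ π e ≟V x ]
        ≡⟨ ∑-concatMap (λ e → 𝟙[ π e ≟V x ]) (λ i → consec (walk i)) (allFin m) ⟩
      ∑[ i ∈ allFin m ] ∑[ e ∈ consec (walk i) ] 𝟙[ π e ≟V x ]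
        ≡⟨ ∑-cong (λ i → trans (sym (∑-map (λ y → 𝟙[ y ≟V x ]) π (consec (walk i))))
                               (cong (count x) (π-walk i))) (allFin m) ⟩
      ∑[ i ∈ allFin m ] count x (side i)
        ∎

  count-inner-original : ∀ w i → count (inj₁ w) (inner i) ≡ 0
  count-inner-original w i =
    trans (∑-map (λ y → 𝟙[ y ≟V inj₁ w ]) (λ j → inj₂ (i , j)) (allFin k))
          (∑-zero (λ j → 𝟙-no (inj₂ (i , j) ≟V inj₁ w) (λ ())) (allFin k))

  count-inner-new : ∀ i i₀ j₀ → count (inj₂ (i₀ , j₀)) (inner i) ≡ 𝟙[ i ≟ᶠ i₀ ]
  count-inner-new i i₀ j₀ with i ≟ᶠ i₀
  ... | yes refl =
    trans (∑-map (λ y → 𝟙[ y ≟V inj₂ (i₀ , j₀) ]) (λ j → inj₂ (i₀ , j)) (allFin k))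
          (trans (∑-allFin-single _ j₀ (λ j j≢j₀ → 𝟙-no _ (λ eq → j≢j₀ (cong proj₂ (inj₂-injective eq)))))
                 (𝟙-yes (inj₂ (i₀ , j₀) ≟V inj₂ (i₀ , j₀)) refl))
  ... | no i≢i₀ =
    trans (∑-map (λ y → 𝟙[ y ≟V inj₂ (i₀ , j₀) ]) (λ j → inj₂ (i , j)) (allFin k))
          (∑-zero (λ j → 𝟙-no _ (λ eq → i≢i₀ (cong proj₁ (inj₂-injective eq)))) (allFin k))

  deg-original : ∀ w → deg (subdivision k G) (inj₁ w) ≡ deg (asGraph G) w
  deg-original w = begin
    deg (subdivision k G) (inj₁ w)
      ≡⟨ deg-subdivision (inj₁ w) ⟩
    ∑[ i ∈ allFin m ] (count (inj₁ w) (inj₁ (u i) ∷ inner i) + count (inj₁ w) (inner i ++ inj₁ (v i) ∷ []))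
      ≡⟨ ∑-cong ends (allFin m) ⟩
    ∑[ i ∈ allFin m ] (𝟙[ u i ≟ᶠ w ] + 𝟙[ v i ≟ᶠ w ])
      ≡⟨ sym (deg-asGraph G w) ⟩
    deg (asGraph G) w
      ∎
    where
    open ≡-Reasoning
    𝟙-inj₁ : ∀ a → 𝟙[ inj₁ a ≟V inj₁ w ] ≡ 𝟙[ a ≟ᶠ w ]
    𝟙-inj₁ a = 𝟙-cong (inj₁ a ≟V inj₁ w) (a ≟ᶠ w) inj₁-injective (cong inj₁)
    ends : ∀ i → count (inj₁ w) (inj₁ (u i) ∷ inner i) + count (inj₁ w) (inner i ++ inj₁ (v i) ∷ [])
                 ≡ 𝟙[ u i ≟ᶠ w ] + 𝟙[ v i ≟ᶠ w ]
    ends i = cong₂ _+_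
      (trans (cong (𝟙[ inj₁ (u i) ≟V inj₁ w ] +_) (count-inner-original w i))
             (trans (+-identityʳ _) (𝟙-inj₁ (u i))))
      (trans (count-snoc (inj₁ w) (inner i) (inj₁ (v i)))
             (cong₂ _+_ (count-inner-original w i) (𝟙-inj₁ (v i))))

  deg-inner : ∀ i₀ j₀ → deg (subdivision k G) (inj₂ (i₀ , j₀)) ≡ 2
  deg-inner i₀ j₀ = begin
    deg (subdivision k G) x
      ≡⟨ deg-subdivision x ⟩
    ∑[ i ∈ allFin m ] (count x (inj₁ (u i) ∷ inner i) + count x (inner i ++ inj₁ (v i) ∷ []))
      ≡⟨ ∑-cong ends (allFin m) ⟩
    ∑[ i ∈ allFin m ] (𝟙[ i ≟ᶠ i₀ ] + 𝟙[ i ≟ᶠ i₀ ])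
      ≡⟨ ∑-allFin-single _ i₀ (λ i i≢i₀ → cong₂ _+_ (𝟙-no (i ≟ᶠ i₀) i≢i₀) (𝟙-no (i ≟ᶠ i₀) i≢i₀)) ⟩
    𝟙[ i₀ ≟ᶠ i₀ ] + 𝟙[ i₀ ≟ᶠ i₀ ]
      ≡⟨ cong₂ _+_ (𝟙-yes (i₀ ≟ᶠ i₀) refl) (𝟙-yes (i₀ ≟ᶠ i₀) refl) ⟩
    2 ∎
    where
    open ≡-Reasoning
    x : V
    x = inj₂ (i₀ , j₀)
    ends : ∀ i → count x (inj₁ (u i) ∷ inner i) + count x (inner i ++ inj₁ (v i) ∷ [])
                 ≡ 𝟙[ i ≟ᶠ i₀ ] + 𝟙[ i ≟ᶠ i₀ ]
    ends i = cong₂ _+_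
      (trans (cong (_+ count x (inner i)) (𝟙-no (inj₁ (u i) ≟V x) (λ ())))
             (count-inner-new i i₀ j₀))
      (trans (count-snoc x (inner i) (inj₁ (v i)))
             (trans (cong (count x (inner i) +_) (𝟙-no (inj₁ (v i) ≟V x) (λ ())))
                    (trans (+-identityʳ _) (count-inner-new i i₀ j₀))))

module _ {n m : ℕ} (k : ℕ) (G : SimpleGraph n m) where
  open SimpleGraph G
  open SubdivisionDegrees (suc k) G using (walk; deg-original; deg-inner)

  private
    u v : Fin m → Fin n
    u i = proj₁ (edge i)
    v i = proj₂ (edge i)

    D : Graph.V (subdivision (suc k) G) → ℕ
    D = deg (subdivision (suc k) G)

    d : Fin n → ℕ
    d = deg (asGraph G)

  HM-walk : ∀ i → ∑[ e ∈ consec (walk i) ] ((D (proj₁ e) + D (proj₂ e)) ^ 2)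
                  ≡ (d (u i) + 2) ^ 2 + (d (v i) + 2) ^ 2 + 16 * k
  HM-walk i = begin
    ∑[ e ∈ consec (walk i) ] ((D (proj₁ e) + D (proj₂ e)) ^ 2)
      ≡⟨ ∑-consec-inner-degree-2 D (inj₁ (u i)) (inj₂ (i , fzero)) later (inj₁ (v i))
           (map⁺ (universal (deg-inner i) (allFin (suc k)))) ⟩
    (D (inj₁ (u i)) + 2) ^ 2 + 16 * length later + (2 + D (inj₁ (v i))) ^ 2
      ≡⟨ cong₂ (λ a b → (a + 2) ^ 2 + 16 * length later + b ^ 2)
               (deg-original (u i)) (trans (cong (2 +_) (deg-original (v i))) (+-comm 2 (d (v i)))) ⟩
    (d (u i) + 2) ^ 2 + 16 * length later + (d (v i) + 2) ^ 2
      ≡⟨ cong (λ l → (d (u i) + 2) ^ 2 + 16 * l + (d (v i) + 2) ^ 2)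
              (trans (length-map (λ j → inj₂ (i , j)) (tabulate {n = k} fsuc)) (length-tabulate {n = k} (fsuc {k}))) ⟩
    (d (u i) + 2) ^ 2 + 16 * k + (d (v i) + 2) ^ 2
      ≡⟨ swap ((d (u i) + 2) ^ 2) (16 * k) ((d (v i) + 2) ^ 2) ⟩
    (d (u i) + 2) ^ 2 + (d (v i) + 2) ^ 2 + 16 * k
      ∎
    where
    open ≡-Reasoning
    later : List (Graph.V (subdivision (suc k) G))
    later = map (λ j → inj₂ (i , j)) (tabulate {n = k} fsuc)
    swap : ∀ P L Q → P + L + Q ≡ P + Q + L
    swap = solve-∀

  -- This is S_{k+1}(G); the 8m is moved to the left to avoid truncated subtraction.
  HM-subdivision : HM (subdivision (suc k) G) + 8 * m ≡ Fidx (asGraph G) + 4 * M₁ (asGraph G) + 16 * suc k * m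
  HM-subdivision = begin
    HM (subdivision (suc k) G) + 8 * m
      ≡⟨ cong (_+ 8 * m) (∑-concatMap (λ e → (D (proj₁ e) + D (proj₂ e)) ^ 2) (λ i → consec (walk i)) (allFin m)) ⟩
    ∑[ i ∈ allFin m ] ∑[ e ∈ consec (walk i) ] ((D (proj₁ e) + D (proj₂ e)) ^ 2) + 8 * m
      ≡⟨ cong (_+ 8 * m) (trans (∑-cong HM-walk (allFin m)) (∑-+ _ _ (allFin m))) ⟩
    ∑[ i ∈ allFin m ] ((d (u i) + 2) ^ 2 + (d (v i) + 2) ^ 2) + ∑[ i ∈ allFin m ] (16 * k) + 8 * m
      ≡⟨ cong₂ (λ a b → a + b + 8 * m)
               (∑-ends-[deg+2]² G) (trans (∑-const (16 * k) (allFin m)) (cong (_* (16 * k)) (length-allFin m))) ⟩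
    Fidx (asGraph G) + 4 * M₁ (asGraph G) + 4 * (m * 2) + m * (16 * k) + 8 * m
      ≡⟨ collect (Fidx (asGraph G)) (M₁ (asGraph G)) m k ⟩
    Fidx (asGraph G) + 4 * M₁ (asGraph G) + 16 * suc k * m
      ∎
    where
    open ≡-Reasoning
    collect : ∀ F M m k → F + 4 * M + 4 * (m * 2) + m * (16 * k) + 8 * m ≡ F + 4 * M + 16 * suc k * m
    collect = solve-∀

theorem2p6 : (n m k : ℕ) (G : SimpleGraph n m) → Connected G → 1 ≤ k →
    HM (subdivision k G)
      ≡ (Fidx (asGraph G) + 4 * M₁ (asGraph G) + 16 * k * m) ∸ 8 * m
theorem2p6 n m (suc k) G _ _ =
  trans (sym (m+n∸n≡m (HM (subdivision (suc k) G)) (8 * m))) (cong (_∸ 8 * m) (HM-subdivision k G))
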